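{- Let $q$ be an odd prime power and let $\mathcal{C}=\varphi\times\chi$ be the combined coloring of the complete graph on $\mathbb{F}_q^2$ defined in the context. There do not exist distinct $a,b,c,d,e\in\mathbb{F}_q^2$ with $\mathcal{C}(ab)=\mathcal{C}(cd)$, $\mathcal{C}(bc)=\mathcal{C}(ad)$, $\mathcal{C}(ae)=\mathcal{C}(ce)$ and $\mathcal{C}(be)=\mathcal{C}(de)$.
   Context: Modified CFLS coloring: for a positive integer $\ell$ and $x,y\in\{0,1\}^{\ell^2}$ distinct, write $v=(v^{(1)},\dots,v^{(\ell)})$ in blocks $v^{(k)}\in\{0,1\}^\ell$; let $\varphi_1(x,y)=((i,\{x^{(i)},y^{(i)}\}),i_1,\dots,i_\ell)$ where $i$ is the least index with $x^{(i)}\ne y^{(i)}$ and $i_k=0$ if $x^{(k)}=y^{(k)}$, else $i_k$ is the least bit position where $x^{(k)},y^{(k)}$ differ. Strings are ordered as binary integers (first bit most significant); for $x<y$, $\varphi_2(x,y)=\varphi_2(y,x)=(\delta_1,\dots,\delta_\ell)$ with $\delta_k=-1$ if $x^{(k)}>y^{(k)}$, $+1$ if $x^{(k)}\le y^{(k)}$; $\varphi=(\varphi_1,\varphi_2)$. Embedding: fix a linear order on $\mathbb{F}_q$; for $\alpha\in\mathbb{F}_q$ let $\alpha'\in\{0,1\}^{\lceil\log_2 q\rceil}$ be the binary representation of the rank of $\alpha$. Let $\ell$ be the least positive integer with $2\lceil\log_2 q\rceil\le\ell^2$, and map $x=(x_1,x_2)\in\mathbb{F}_q^2$ to $\sigma(x)=(x_1',x_2',0,\dots,0)\in\{0,1\}^{\ell^2}$.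 Order $\mathbb{F}_q^2$ by $x<y$ iff $\sigma(x)<\sigma(y)$. Algebraic coloring: $\chi_1(xy)=(x_1y_1-x_2-y_2,\delta(x_1,y_1))$, $\delta=0$ if $x_1=y_1$, else $1$. For $\alpha\in\mathbb{F}_q$, the pairs $\{x,y\}\subseteq\mathbb{F}_q\setminus\{\alpha\}$ with $x+y=2\alpha$ form a perfect matching; fix a partition $\mathbb{F}_q\setminus\{\alpha\}=S_\alpha\cup T_\alpha$ separating each matched pair, and let $f_\alpha(\beta)=S$ or $T$ according as $\beta\in S_\alpha$ or $T_\alpha$. For $x<y$ with $x_1\ne y_1$, $\chi_2(xy)=(f_{x_1}(y_1),f_{y_1}(x_1))$; if $x_1=y_1$, $\chi_2(xy)$ is a fixed value. $\chi=(\chi_1,\chi_2)$. Combined: $\mathcal{C}(xy)=(\varphi(\sigma(x),\sigma(y)),\chi(xy))$. -}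

module Defs where

open import Level using (0ℓ)
open import Algebra.Bundles using (CommutativeRing)
open import Data.Bool using (Bool; true; false; not; _∧_; if_then_else_)
open import Data.Nat using (ℕ; zero; suc; _∸_; _<ᵇ_; _≡ᵇ_; _/_; _%_)
open import Data.Fin using (Fin; toℕ)
import Data.Nat as Nat
import Data.Fin as Fin
open import Data.Vec using (Vec; []; _∷_; _∷ʳ_; concat; tabulate; lookup)
open import Data.Maybe using (Maybe; just; nothing)
open import Data.Product using (_×_; _,_; ∃)
open import Data.Sign using (Sign)
open import Relation.Binary.PropositionalEquality using (_≡_)
open import Relation.Nullary using (¬_)

record Field : Set₁ where
  field
    commRing : CommutativeRing 0ℓ 0ℓ
  open CommutativeRing commRing public
  field
    ≈⇒≡  : ∀ {x y} → x ≈ y → x ≡ y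
    0≢1  : ¬ (0# ≡ 1#)
    inv  : ∀ x → ¬ (x ≡ 0#) → ∃ λ y → x * y ≡ 1#

_==_ : Bool → Bool → Bool
true  == b = b
false == b = not b

eqBits : ∀ {n} → Vec Bool n → Vec Bool n → Bool
eqBits []       []       = true
eqBits (a ∷ as) (b ∷ bs) = (a == b) ∧ eqBits as bs

-- strict order of equal-length bit strings read as binary integers
-- (first bit most significant) = lexicographic order with 0 < 1
ltBits : ∀ {n} → Vec Bool n → Vec Bool n → Bool
ltBits []       []       = false
ltBits (a ∷ as) (b ∷ bs) = if a == b then ltBits as bs else (not a ∧ b)

-- binary representation of n with m bits, most significant bit first
toBits : (m : ℕ) → ℕ → Vec Bool m
toBits zero    n = []
toBits (suc m) n = toBits m (n / 2) ∷ʳ (n % 2 ≡ᵇ 1)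

firstDiff : ∀ {A : Set} {n} → (A → A → Bool) → Vec A n → Vec A n → Maybe (Fin n)
firstDiff eq []       []       = nothing
firstDiff eq (a ∷ as) (b ∷ bs) with eq a b
... | false = just Fin.zero
... | true  with firstDiff eq as bs
...   | nothing = nothing
...   | just i  = just (Fin.suc i)

-- padded lookup: bits beyond the length are 0
get : ∀ {n} → Vec Bool n → ℕ → Bool
get []       _       = false
get (b ∷ bs) zero    = b
get (b ∷ bs) (suc j) = get bs j

-- The modified CFLS coloring φ on {0,1}^{ℓ²}, strings given in blocks
-- v = (v⁽¹⁾,…,v⁽ℓ⁾); the string itself is concat v.

Blocks : ℕ → Set
Blocks ℓ = Vec (Vec Bool ℓ) ℓ

-- unordered pair {u,w} of blocks, represented canonically as (min,max)
upair : ∀ {ℓ} → Vec Bool ℓ → Vec Bool ℓ → Vec Bool ℓ × Vec Bool ℓ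
upair u w = if ltBits u w then (u , w) else (w , u)

-- φ₁(x,y) = ((i,{x⁽ⁱ⁾,y⁽ⁱ⁾}), i₁,…,i_ℓ); index i = nothing only if x = y.
-- i_k = nothing encodes i_k = 0, i_k = just t encodes bit position t+1.
Φ₁ : ℕ → Set
Φ₁ ℓ = Maybe (Fin ℓ × (Vec Bool ℓ × Vec Bool ℓ)) × Vec (Maybe (Fin ℓ)) ℓ

φ₁ : ∀ {ℓ} → Blocks ℓ → Blocks ℓ → Φ₁ ℓ
φ₁ x y = first , tabulate (λ k → firstDiff _==_ (lookup x k) (lookup y k))
  where
  first : Maybe _
  first with firstDiff eqBits x y
  ... | nothing = nothing
  ... | just i  = just (i , upair (lookup x i) (lookup y i))

deltas : ∀ {ℓ} → Blocks ℓ → Blocks ℓ → Vec Sign ℓ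
deltas x y = tabulate λ k →
  if ltBits (lookup y k) (lookup x k) then Sign.- else Sign.+

φ₂ : ∀ {ℓ} → Blocks ℓ → Blocks ℓ → Vec Sign ℓ
φ₂ x y = if ltBits (concat x) (concat y) then deltas x y else deltas y x

φ : ∀ {ℓ} → Blocks ℓ → Blocks ℓ → Φ₁ ℓ × Vec Sign ℓ
φ x y = φ₁ x y , φ₂ x y

-- Parameters: the field F, a rank function (the fixed linear order on F,
-- assumed a bijection onto Fin q in the theorem), the number of bits m,
-- the block length ℓ, and the partition functions f α β ∈ {S = true, T = false}.

module Coloring (F : Field) (q : ℕ) (rank : Field.Carrier F → Fin q)
                (m ℓ : ℕ) (f : Field.Carrier F → Field.Carrier F → Bool) where
  open Field F

  Pt : Set
  Pt = Carrier × Carrier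

  bin : Carrier → Vec Bool m
  bin α = toBits m (toℕ (rank α))

  -- j-th bit of σ(x) = (x₁', x₂', 0, …, 0)
  σbit : Pt → ℕ → Bool
  σbit (x₁ , x₂) j = if j <ᵇ m then get (bin x₁) j else get (bin x₂) (j ∸ m)

  -- σ(x) ∈ {0,1}^{ℓ²} in blocks: block k, bit t is position kℓ + t
  σ : Pt → Blocks ℓ
  σ x = tabulate λ k → tabulate λ t → σbit x (toℕ k Nat.* ℓ Nat.+ toℕ t)

  ltPt : Pt → Pt → Bool
  ltPt x y = ltBits (concat (σ x)) (concat (σ y))

  eqF : Carrier → Carrier → Bool
  eqF a b = toℕ (rank a) ≡ᵇ toℕ (rank b)

  χ₁ : Pt → Pt → Carrier × Bool
  χ₁ (x₁ , x₂) (y₁ , y₂) = (x₁ * y₁ - x₂ - y₂) , not (eqF x₁ y₁)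

  χ₂< : Pt → Pt → Maybe (Bool × Bool)
  χ₂< (x₁ , _) (y₁ , _) =
    if eqF x₁ y₁ then nothing else just (f x₁ y₁ , f y₁ x₁)

  χ₂ : Pt → Pt → Maybe (Bool × Bool)
  χ₂ x y = if ltPt x y then χ₂< x y else χ₂< y x

  χ : Pt → Pt → (Carrier × Bool) × Maybe (Bool × Bool)
  χ x y = χ₁ x y , χ₂ x y

  Color : Set
  Color = (Φ₁ ℓ × Vec Sign ℓ) × ((Carrier × Bool) × Maybe (Bool × Bool))

  𝒞 : Pt → Pt → Color
  𝒞 x y = φ (σ x) (σ y) , χ x y

module Submission where

open import Defs
open import Data.Nat using (ℕ; _≤_; _<_; _^_; suc)
import Data.Nat as Nat
open import Data.Nat.Logarithm using (⌈log₂_⌉)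
open import Data.Nat.Primality using (Prime)
open import Data.Fin using (Fin)
open import Data.Bool using (Bool)
open import Data.Product using (_×_; ∃)
open import Function.Definitions using (Bijective)
open import Relation.Binary.PropositionalEquality using (_≡_)
open import Relation.Nullary using (¬_)

open import Data.Bool using (true; false; T)
open import Data.Empty using (⊥; ⊥-elim)
open import Data.Fin.Properties using (toℕ-injective)
open import Data.Maybe using (Maybe; just; nothing)
open import Data.Maybe.Properties using (just-injective)
open import Data.Nat.Properties using (≡ᵇ⇒≡)
open import Data.Product using (_,_; proj₁; proj₂)
open import Data.Unit using (tt)
open import Data.Vec using (Vec; []; _∷_; _++_; concat; lookup)
open import Function using (_∘_)
import Relation.Binary.PropositionalEquality as ≡

-- Suppose a, b, c, d, e form the forbidden configuration.  Write x = (x₁, x₂).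
--
-- The first component of χ₁ is the value
--   x₁y₁ - x₂ - y₂.  From 𝒞(ae) = 𝒞(ce) and 𝒞(be) = 𝒞(de) we get a₁ ≠ c₁ and
--   b₁ ≠ d₁ (equal first coordinates would force a = c, resp. b = d).  Adding
--   the value equations of ab ~ cd, bc ~ ad and twice be ~ de gives
--   (b₁ - d₁)(a₁ + c₁ - 2e₁) = 0, so a₁ + c₁ = 2e₁: c₁ is the reflection of a₁
--   in e₁, and both differ from e₁.
-- * Bit strings (module BitStrings).  The first component of φ₁(x, z), the
--   first differing block together with the unordered pair of blocks there,
--   determines (given z) whether x < z.  Hence 𝒞(ae) = 𝒞(ce) forces a and c to
--   lie on the same side of e.
-- * Colouring χ₂ (module EdgeColours).  On an edge xe with x₁ ≠ e₁, χ₂ records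
--   f_{e₁}(x₁) in a slot fixed by the order of x and e.  As a and c are on the
--   same side of e, f_{e₁}(a₁) = f_{e₁}(c₁) = f_{e₁}(2e₁ - a₁), contradicting
--   the choice of the partition, which separates β from 2e₁ - β.
--
-- The theorem lemma16 unpacks the hypotheses and applies the result of
-- module Configuration.

module BitStrings where
  open ≡ using (refl; cong; cong₂; sym; trans; module ≡-Reasoning)

  ==-refl : ∀ a → (a == a) ≡ true
  ==-refl true  = refl
  ==-refl false = refl

  ==⇒≡ : ∀ {a b} → (a == b) ≡ true → a ≡ b
  ==⇒≡ {true}  {true}  _ = refl
  ==⇒≡ {false} {false} _ = refl

  eqBits-refl : ∀ {n} (u : Vec Bool n) → eqBits u u ≡ true
  eqBits-refl []      = refl
  eqBits-refl (a ∷ u) rewrite ==-refl a = eqBits-refl u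

  eqBits⇒≡ : ∀ {n} {u w : Vec Bool n} → eqBits u w ≡ true → u ≡ w
  eqBits⇒≡ {u = []}    {[]}    _ = refl
  eqBits⇒≡ {u = a ∷ u} {b ∷ w} h with a == b in e
  ... | true = cong₂ _∷_ (==⇒≡ e) (eqBits⇒≡ h)

  ltBits-++-equal : ∀ {n m} (u : Vec Bool n) {w : Vec Bool n} (s t : Vec Bool m) →
    eqBits u w ≡ true → ltBits (u ++ s) (w ++ t) ≡ ltBits s t
  ltBits-++-equal u {w} s t h with refl ← eqBits⇒≡ {u = u} {w} h = same-prefix u
    where
    same-prefix : ∀ {n} (u : Vec Bool n) → ltBits (u ++ s) (u ++ t) ≡ ltBits s t
    same-prefix []      = refl
    same-prefix (a ∷ u) rewrite ==-refl a = same-prefix u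

  ltBits-++-differ : ∀ {n m} (u w : Vec Bool n) (s t : Vec Bool m) →
    eqBits u w ≡ false → ltBits (u ++ s) (w ++ t) ≡ ltBits u w
  ltBits-++-differ []      []      s t ()
  ltBits-++-differ (a ∷ u) (b ∷ w) s t h with a == b
  ... | true  = ltBits-++-differ u w s t h
  ... | false = refl

  upair-order : ∀ {n} (u w : Vec Bool n) → eqBits u w ≡ false →
    ltBits u w ≡ eqBits (proj₂ (upair u w)) w
  upair-order u w h with ltBits u w
  ... | true  = sym (eqBits-refl w)
  ... | false = sym h

  module _ {ℓ : ℕ} where

    firstDiff-nothing : ∀ {n} (x z : Vec (Vec Bool ℓ) n) → firstDiff eqBits x z ≡ nothing →
      ltBits (concat x) (concat z) ≡ false
    firstDiff-nothing []      []      _ = refl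
    firstDiff-nothing (u ∷ x) (w ∷ z) h with eqBits u w in e
    firstDiff-nothing (u ∷ x) (w ∷ z) () | false
    ... | true with firstDiff eqBits x z in e′
    firstDiff-nothing (u ∷ x) (w ∷ z) () | true | just _
    ...   | nothing = trans (ltBits-++-equal u (concat x) (concat z) e) (firstDiff-nothing x z e′)

    firstDiff-differs : ∀ {n} (x z : Vec (Vec Bool ℓ) n) {i : Fin n} →
      firstDiff eqBits x z ≡ just i → eqBits (lookup x i) (lookup z i) ≡ false
    firstDiff-differs (u ∷ x) (w ∷ z) h with eqBits u w in e
    firstDiff-differs (u ∷ x) (w ∷ z) refl | false = e
    ... | true with firstDiff eqBits x z in e′
    firstDiff-differs (u ∷ x) (w ∷ z) refl | true | just _ = firstDiff-differs x z e′

    firstDiff-decides : ∀ {n} (x z : Vec (Vec Bool ℓ) n) {i : Fin n} →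
      firstDiff eqBits x z ≡ just i →
      ltBits (concat x) (concat z) ≡ ltBits (lookup x i) (lookup z i)
    firstDiff-decides (u ∷ x) (w ∷ z) h with eqBits u w in e
    firstDiff-decides (u ∷ x) (w ∷ z) refl | false = ltBits-++-differ u w (concat x) (concat z) e
    ... | true with firstDiff eqBits x z in e′
    firstDiff-decides (u ∷ x) (w ∷ z) refl | true | just _ =
      trans (ltBits-++-equal u (concat x) (concat z) e) (firstDiff-decides x z e′)

    -- whether x < z, read off from the first component of φ₁(x, z) and z
    orderFrom : Maybe (Fin ℓ × (Vec Bool ℓ × Vec Bool ℓ)) → Blocks ℓ → Bool
    orderFrom nothing                  z = false
    orderFrom (just (i , (_ , upper))) z = eqBits upper (lookup z i)

    order-read-off : (x z : Blocks ℓ) →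
      ltBits (concat x) (concat z) ≡ orderFrom (proj₁ (φ₁ x z)) z
    order-read-off x z with firstDiff eqBits x z in e
    ... | nothing = firstDiff-nothing x z e
    ... | just i  = trans (firstDiff-decides x z e)
                          (upair-order (lookup x i) (lookup z i) (firstDiff-differs x z e))

    same-side : (x y z : Blocks ℓ) → proj₁ (φ₁ x z) ≡ proj₁ (φ₁ y z) →
      ltBits (concat x) (concat z) ≡ ltBits (concat y) (concat z)
    same-side x y z h = begin
      ltBits (concat x) (concat z)   ≡⟨ order-read-off x z ⟩
      orderFrom (proj₁ (φ₁ x z)) z   ≡⟨ cong (λ t → orderFrom t z) h ⟩
      orderFrom (proj₁ (φ₁ y z)) z   ≡⟨ order-read-off y z ⟨
      ltBits (concat y) (concat z)   ∎
      where open ≡-Reasoning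

module FieldAlgebra (F : Field) where
  open Field F
  open import Algebra.Properties.Ring ring
    using (//-rightDividesˡ; //-rightDividesʳ; +-cancelˡ; +-cancelʳ; x≈z//y;
           x∙y⁻¹≈ε⇒x≈y; -‿+-comm; [y-z]x≈yx-zx)
  open import Algebra.Properties.CommutativeSemigroup +-commutativeSemigroup
    using (xy∙z≈xz∙y)
  open import Algebra.Solver.Ring.NaturalCoefficients.Default commutativeSemiring
  open import Relation.Binary.Reasoning.Setoid setoid

  difference⇒sum : ∀ {u p v q} → u - p ≈ v - q → u + q ≈ v + p
  difference⇒sum {u} {p} {v} {q} h = begin
    u + q             ≈⟨ +-congʳ (//-rightDividesˡ p u) ⟨
    (u - p) + p + q   ≈⟨ +-congʳ (+-congʳ h) ⟩
    (v - q) + p + q   ≈⟨ xy∙z≈xz∙y (v - q) p q ⟩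
    (v - q) + q + p   ≈⟨ +-congʳ (//-rightDividesˡ q v) ⟩
    v + p             ∎

  sum⇒difference : ∀ {u p v q} → u + q ≈ v + p → u - p ≈ v - q
  sum⇒difference {u} {p} {v} {q} h = begin
    u - p             ≈⟨ //-rightDividesʳ q (u - p) ⟨
    (u - p) + q - q   ≈⟨ +-congʳ (xy∙z≈xz∙y u (- p) q) ⟩
    (u + q) - p - q   ≈⟨ +-congʳ (+-congʳ h) ⟩
    (v + p) - p - q   ≈⟨ +-congʳ (//-rightDividesʳ p v) ⟩
    v - q             ∎

  value-balance : ∀ {x p q y r s} → x - p - q ≈ y - r - s → x + (r + s) ≈ y + (p + q)
  value-balance {x} {p} {q} {y} {r} {s} h = difference⇒sum (begin
    x - (p + q)   ≈⟨ minus-sum x p q ⟨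
    x - p - q     ≈⟨ h ⟩
    y - r - s     ≈⟨ minus-sum y r s ⟩
    y - (r + s)   ∎)
    where
    minus-sum : ∀ z p q → z - p - q ≈ z - (p + q)
    minus-sum z p q = trans (+-assoc z (- p) (- q)) (+-congˡ (-‿+-comm p q))

  *-cancel-nonzero : ∀ {u x y} → ¬ u ≡ 0# → u * x ≈ u * y → x ≈ y
  *-cancel-nonzero {u} {x} {y} u≢0 h with inv u u≢0
  ... | w , uw≡1 = begin
    x             ≈⟨ *-identityˡ x ⟨
    1# * x        ≈⟨ *-congʳ (reflexive uw≡1) ⟨
    (u * w) * x   ≈⟨ swap u w x ⟩
    w * (u * x)   ≈⟨ *-congˡ h ⟩
    w * (u * y)   ≈⟨ swap u w y ⟨
    (u * w) * y   ≈⟨ *-congʳ (reflexive uw≡1) ⟩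
    1# * y        ≈⟨ *-identityˡ y ⟩
    y             ∎
    where
    swap : ∀ u w x → (u * w) * x ≈ w * (u * x)
    swap = solve 3 (λ u w x → (u :* w) :* x := w :* (u :* x)) refl

  -- b X + d Y = d X + b Y says (b - d) X = (b - d) Y, so X = Y when b ≠ d
  cross-cancel : ∀ {b d X Y} → ¬ b ≡ d → b * X + d * Y ≈ d * X + b * Y → X ≈ Y
  cross-cancel {b} {d} {X} {Y} b≢d h = *-cancel-nonzero b-d≢0 (begin
    (b - d) * X     ≈⟨ [y-z]x≈yx-zx X b d ⟩
    b * X - d * X   ≈⟨ sum⇒difference (trans h (+-comm (d * X) (b * Y))) ⟩
    b * Y - d * Y   ≈⟨ [y-z]x≈yx-zx Y b d ⟨
    (b - d) * Y     ∎)
    where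
    b-d≢0 : ¬ b - d ≡ 0#
    b-d≢0 b-d≡0 = b≢d (≈⇒≡ (x∙y⁻¹≈ε⇒x≈y b d (reflexive b-d≡0)))

  -- the sum of the balanced equations for ab ~ cd, bc ~ ad and twice be ~ de,
  -- after cancelling the second coordinates
  four-point-identity : ∀ {a₁ a₂ b₁ b₂ c₁ c₂ d₁ d₂ e₁ e₂} →
    a₁ * b₁ + (c₂ + d₂) ≈ c₁ * d₁ + (a₂ + b₂) →
    b₁ * c₁ + (a₂ + d₂) ≈ a₁ * d₁ + (b₂ + c₂) →
    b₁ * e₁ + (d₂ + e₂) ≈ d₁ * e₁ + (b₂ + e₂) →
    b₁ * (a₁ + c₁) + d₁ * (e₁ + e₁) ≈ d₁ * (a₁ + c₁) + b₁ * (e₁ + e₁)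
  four-point-identity {a₁} {a₂} {b₁} {b₂} {c₁} {c₂} {d₁} {d₂} {e₁} {e₂} E₁ E₂ E₄ =
    +-cancelʳ K _ _ (begin
      b₁ * (a₁ + c₁) + d₁ * (e₁ + e₁) + K
        ≈⟨ solve 10 (λ a₁ a₂ b₁ b₂ c₁ c₂ d₁ d₂ e₁ e₂ →
             b₁ :* (a₁ :+ c₁) :+ d₁ :* (e₁ :+ e₁)
               :+ (a₂ :+ c₂ :+ (b₂ :+ b₂) :+ (d₂ :+ d₂) :+ (e₂ :+ e₂))
             := (a₁ :* b₁ :+ (c₂ :+ d₂)) :+ (b₁ :* c₁ :+ (a₂ :+ d₂))
               :+ ((d₁ :* e₁ :+ (b₂ :+ e₂)) :+ (d₁ :* e₁ :+ (b₂ :+ e₂))))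
             refl a₁ a₂ b₁ b₂ c₁ c₂ d₁ d₂ e₁ e₂ ⟩
      (a₁ * b₁ + (c₂ + d₂)) + (b₁ * c₁ + (a₂ + d₂))
        + ((d₁ * e₁ + (b₂ + e₂)) + (d₁ * e₁ + (b₂ + e₂)))
        ≈⟨ +-cong (+-cong E₁ E₂) (+-cong (sym E₄) (sym E₄)) ⟩
      (c₁ * d₁ + (a₂ + b₂)) + (a₁ * d₁ + (b₂ + c₂))
        + ((b₁ * e₁ + (d₂ + e₂)) + (b₁ * e₁ + (d₂ + e₂)))
        ≈⟨ solve 10 (λ a₁ a₂ b₁ b₂ c₁ c₂ d₁ d₂ e₁ e₂ →
             (c₁ :* d₁ :+ (a₂ :+ b₂)) :+ (a₁ :* d₁ :+ (b₂ :+ c₂))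
               :+ ((b₁ :* e₁ :+ (d₂ :+ e₂)) :+ (b₁ :* e₁ :+ (d₂ :+ e₂)))
             := d₁ :* (a₁ :+ c₁) :+ b₁ :* (e₁ :+ e₁)
               :+ (a₂ :+ c₂ :+ (b₂ :+ b₂) :+ (d₂ :+ d₂) :+ (e₂ :+ e₂)))
             refl a₁ a₂ b₁ b₂ c₁ c₂ d₁ d₂ e₁ e₂ ⟩
      d₁ * (a₁ + c₁) + b₁ * (e₁ + e₁) + K ∎)
    where
    K : Carrier
    K = a₂ + c₂ + (b₂ + b₂) + (d₂ + d₂) + (e₂ + e₂)

  same-abscissa : ∀ {x₁ x₂ y₂ e₁ e₂} → x₁ * e₁ - x₂ - e₂ ≈ x₁ * e₁ - y₂ - e₂ → x₂ ≈ y₂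
  same-abscissa h = sym (+-cancelʳ _ _ _ (+-cancelˡ _ _ _ (value-balance h)))

  midpoint : ∀ {a₁ a₂ b₁ b₂ c₁ c₂ d₁ d₂ e₁ e₂} → ¬ b₁ ≡ d₁ →
    a₁ * b₁ - a₂ - b₂ ≈ c₁ * d₁ - c₂ - d₂ →
    b₁ * c₁ - b₂ - c₂ ≈ a₁ * d₁ - a₂ - d₂ →
    b₁ * e₁ - b₂ - e₂ ≈ d₁ * e₁ - d₂ - e₂ →
    a₁ + c₁ ≈ e₁ + e₁
  midpoint b₁≢d₁ H₁ H₂ H₄ =
    cross-cancel b₁≢d₁ (four-point-identity (value-balance H₁) (value-balance H₂) (value-balance H₄))

  reflection : ∀ {a c e} → a + c ≈ e + e → c ≈ (e + e) - a
  reflection {a} {c} h = x≈z//y c a _ (trans (+-comm c a) h)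

  reflection-distinct : ∀ {a c e} → a + c ≈ e + e → ¬ a ≡ c → ¬ a ≡ e × ¬ c ≡ e
  reflection-distinct {a} {c} {e} h a≢c =
    (λ { ≡.refl → a≢c (≈⇒≡ (sym (+-cancelˡ e c e h))) }) ,
    (λ { ≡.refl → a≢c (≈⇒≡ (+-cancelʳ e a e h)) })

module EdgeColours (F : Field) (q : ℕ) (rank : Field.Carrier F → Fin q)
  (rank-injective : ∀ {x y} → rank x ≡ rank y → x ≡ y)
  (m ℓ : ℕ) (f : Field.Carrier F → Field.Carrier F → Bool) where
  open ≡ using (refl; cong; sym; subst; module ≡-Reasoning)
  open Coloring F q rank m ℓ f

  eqF-distinct : ∀ {x y} → ¬ x ≡ y → eqF x y ≡ false
  eqF-distinct {x} {y} x≢y with eqF x y in e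
  ... | false = refl
  ... | true  = ⊥-elim (x≢y (rank-injective (toℕ-injective (≡ᵇ⇒≡ _ _ (subst T (sym e) tt)))))

  arrange : Bool → Bool → Bool → Bool × Bool
  arrange true  s t = s , t
  arrange false s t = t , s

  arrange-injectiveʳ : ∀ o {s s′ t t′} → arrange o s t ≡ arrange o s′ t′ → t ≡ t′
  arrange-injectiveʳ true  = cong proj₂
  arrange-injectiveʳ false = cong proj₁

  χ₂-edge : ∀ {x e : Pt} → ¬ proj₁ x ≡ proj₁ e →
    χ₂ x e ≡ just (arrange (ltPt x e) (f (proj₁ x) (proj₁ e)) (f (proj₁ e) (proj₁ x)))
  χ₂-edge {x₁ , x₂} {e₁ , e₂} x₁≢e₁ with ltPt (x₁ , x₂) (e₁ , e₂)
  ... | true  rewrite eqF-distinct x₁≢e₁       = refl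
  ... | false rewrite eqF-distinct (x₁≢e₁ ∘ sym) = refl

  same-f-value : ∀ {x y e : Pt} → ltPt x e ≡ ltPt y e →
    ¬ proj₁ x ≡ proj₁ e → ¬ proj₁ y ≡ proj₁ e → χ₂ x e ≡ χ₂ y e →
    f (proj₁ e) (proj₁ x) ≡ f (proj₁ e) (proj₁ y)
  same-f-value {x@(x₁ , _)} {y@(y₁ , _)} {e@(e₁ , _)} same x₁≢e₁ y₁≢e₁ h =
    arrange-injectiveʳ (ltPt x e) (just-injective (begin
      just (arrange (ltPt x e) (f x₁ e₁) (f e₁ x₁))   ≡⟨ χ₂-edge x₁≢e₁ ⟨
      χ₂ x e                                          ≡⟨ h ⟩
      χ₂ y e                                          ≡⟨ χ₂-edge y₁≢e₁ ⟩
      just (arrange (ltPt y e) (f y₁ e₁) (f e₁ y₁))   ≡⟨ cong (λ o → just (arrange o (f y₁ e₁) (f e₁ y₁))) same ⟨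
      just (arrange (ltPt x e) (f y₁ e₁) (f e₁ y₁))   ∎))
    where open ≡-Reasoning

module Configuration (F : Field) (q : ℕ) (rank : Field.Carrier F → Fin q)
  (rank-injective : ∀ {x y} → rank x ≡ rank y → x ≡ y)
  (m ℓ : ℕ) (f : Field.Carrier F → Field.Carrier F → Bool)
  (f-separates : ∀ α β → ¬ (β ≡ α) →
    ¬ (f α β ≡ f α (Field._-_ F (Field._+_ F α α) β))) where
  open ≡ using (refl; cong; trans)
  open Field F hiding (refl; sym; trans)
  open Coloring F q rank m ℓ f
  open BitStrings using (same-side)
  open FieldAlgebra F using (same-abscissa; midpoint; reflection; reflection-distinct)
  open EdgeColours F q rank rank-injective m ℓ f using (same-f-value)

  value : ∀ {x y u v} → 𝒞 x y ≡ 𝒞 u v → proj₁ (χ₁ x y) ≈ proj₁ (χ₁ u v)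
  value h = reflexive (cong (proj₁ ∘ proj₁ ∘ proj₂) h)

  no-configuration : (a b c d e : Pt) → ¬ a ≡ c → ¬ b ≡ d →
    𝒞 a b ≡ 𝒞 c d → 𝒞 b c ≡ 𝒞 a d → 𝒞 a e ≡ 𝒞 c e → 𝒞 b e ≡ 𝒞 d e → ⊥
  no-configuration (a₁ , a₂) (b₁ , b₂) (c₁ , c₂) (d₁ , d₂) (e₁ , e₂) a≢c b≢d ab~cd bc~ad ae~ce be~de =
    f-separates e₁ a₁ a₁≢e₁ (trans f-equal (cong (f e₁) (≈⇒≡ (reflection a₁+c₁≈2e₁))))
    where
    a₁≢c₁ : ¬ a₁ ≡ c₁
    a₁≢c₁ refl = a≢c (cong (a₁ ,_) (≈⇒≡ (same-abscissa (value ae~ce))))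
    b₁≢d₁ : ¬ b₁ ≡ d₁
    b₁≢d₁ refl = b≢d (cong (b₁ ,_) (≈⇒≡ (same-abscissa (value be~de))))
    a₁+c₁≈2e₁ : a₁ + c₁ ≈ e₁ + e₁
    a₁+c₁≈2e₁ = midpoint b₁≢d₁ (value ab~cd) (value bc~ad) (value be~de)
    a₁≢e₁ : ¬ a₁ ≡ e₁
    a₁≢e₁ = proj₁ (reflection-distinct a₁+c₁≈2e₁ a₁≢c₁)
    c₁≢e₁ : ¬ c₁ ≡ e₁
    c₁≢e₁ = proj₂ (reflection-distinct a₁+c₁≈2e₁ a₁≢c₁)
    f-equal : f e₁ a₁ ≡ f e₁ c₁
    f-equal = same-f-value
      (same-side (σ (a₁ , a₂)) (σ (c₁ , c₂)) (σ (e₁ , e₂)) (cong (proj₁ ∘ proj₁ ∘ proj₁) ae~ce))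
      a₁≢e₁ c₁≢e₁ (cong (proj₂ ∘ proj₂) ae~ce)

lemma16 : (F : Field) (q p k : ℕ) → Prime p → ¬ (p ≡ 2) → q ≡ p ^ suc k →
    (rank : Field.Carrier F → Fin q) → Bijective _≡_ _≡_ rank →
    (ℓ : ℕ) → 1 ≤ ℓ → 2 Nat.* ⌈log₂ q ⌉ ≤ ℓ Nat.* ℓ →
    (∀ j → 1 ≤ j → j < ℓ → j Nat.* j < 2 Nat.* ⌈log₂ q ⌉) →
    (f : Field.Carrier F → Field.Carrier F → Bool) →
    (∀ α β → ¬ (β ≡ α) →
      ¬ (f α β ≡ f α (Field._-_ F (Field._+_ F α α) β))) →
    let open Coloring F q rank ⌈log₂ q ⌉ ℓ f in
    ¬ (∃ λ (a : Pt) → ∃ λ (b : Pt) → ∃ λ (c : Pt) → ∃ λ (d : Pt) → ∃ λ (e : Pt) →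
        (¬ a ≡ b × ¬ a ≡ c × ¬ a ≡ d × ¬ a ≡ e × ¬ b ≡ c ×
         ¬ b ≡ d × ¬ b ≡ e × ¬ c ≡ d × ¬ c ≡ e × ¬ d ≡ e) ×
        𝒞 a b ≡ 𝒞 c d × 𝒞 b c ≡ 𝒞 a d × 𝒞 a e ≡ 𝒞 c e × 𝒞 b e ≡ 𝒞 d e)
lemma16 F q _ _ _ _ _ rank rank-bijective ℓ _ _ _ f f-separates
        (a , b , c , d , e , (_ , a≢c , _ , _ , _ , b≢d , _) , ab~cd , bc~ad , ae~ce , be~de) =
  Configuration.no-configuration F q rank (proj₁ rank-bijective) ⌈log₂ q ⌉ ℓ f f-separates
    a b c d e a≢c b≢d ab~cd bc~ad ae~ce be~de
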